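{- Let $G=(V,E)$ be a finite connected simple graph and $E'\subset E$ a matching in $G$. Assume $G$ has an independent set $I$ with $|I|=|V|-|E'|$. Then for every $z\in I$ and every $x\in V$ such that $\{x,y\}\in E'$ for some vertex $y$ adjacent to $z$, we have $x\in I$. -}

module Defs where

open import Data.Nat using (ℕ)
open import Data.Bool using (Bool; true; false)
open import Data.Fin using (Fin)
open import Data.Fin.Subset using (Subset; _∈_)
open import Data.Product using (_×_; _,_; proj₁; proj₂)
open import Data.Sum using (_⊎_)
open import Data.List using (List; concatMap; _∷_; [])
open import Data.List.Relation.Unary.All using (All)
open import Data.List.Relation.Unary.Unique.Propositional using (Unique)
import Data.List.Membership.Propositional as LM
open import Relation.Binary.PropositionalEquality using (_≡_)

record SimpleGraph (n : ℕ) : Set where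
  field
    adj     : Fin n → Fin n → Bool
    adj-sym : ∀ u v → adj u v ≡ adj v u
    irrefl  : ∀ u → adj u u ≡ false

open SimpleGraph public

Edge : ∀ {n} → SimpleGraph n → Fin n → Fin n → Set
Edge G u v = adj G u v ≡ true

data Walk {n} (G : SimpleGraph n) : Fin n → Fin n → Set where
  nil  : ∀ {u} → Walk G u u
  cons : ∀ {u v w} → Edge G u v → Walk G v w → Walk G u w

Connected : ∀ {n} → SimpleGraph n → Set
Connected G = ∀ u v → Walk G u v

-- A matching E' is given as a list of edges (each edge listed once, by one
-- of its two orientations) such that all endpoints occurring in the list are
-- pairwise distinct; hence edges are pairwise disjoint and |E'| = length.
endpoints : ∀ {n} → List (Fin n × Fin n) → List (Fin n)
endpoints = concatMap (λ e → proj₁ e ∷ proj₂ e ∷ [])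

IsMatching : ∀ {n} → SimpleGraph n → List (Fin n × Fin n) → Set
IsMatching G M = All (λ e → Edge G (proj₁ e) (proj₂ e)) M × Unique (endpoints M)

InMatching : ∀ {n} → List (Fin n × Fin n) → Fin n → Fin n → Set
InMatching M x y = LM._∈_ (x , y) M ⊎ LM._∈_ (y , x) M

Independent : ∀ {n} → SimpleGraph n → Subset n → Set
Independent G I = ∀ u v → u ∈ I → v ∈ I → adj G u v ≡ false

module Submission where

-- Every edge of G has an endpoint outside the independent set I, so
-- in a matching M the vertices of V ∖ I that are covered by M number at
-- least |M|; if some matching edge {x,y} had both ends outside I they would
-- number at least |M| + 1.  These covered vertices are pairwise distinct
-- (M is a matching), hence at most |V ∖ I| = n − |I| = |M| of them exist.
-- So every matching edge has exactly one endpoint outside I.  For z ∈ I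
-- and y adjacent to z we have y ∉ I, hence the partner x of y lies in I.

open import Defs
open import Level using (Level)
open import Data.Nat using (ℕ; suc; _∸_; _≤_; _<_; s≤s; z≤n)
open import Data.Nat.Properties
  using (≤-refl; ≤-trans; ≤-reflexive; n≤1+n; <-≤-trans; ≤⇒≯; ≤-total; m∸n≤m; m∸[m∸n]≡n)
open import Function using (_∘_)
open import Data.Empty using (⊥; ⊥-elim)
open import Data.Fin using (Fin)
open import Data.Fin.Subset using (Subset; _∈_; _∉_; ∣_∣; ∁; _-_)
open import Data.Fin.Subset.Properties
  using (_∈?_; x∈p∧x≢y⇒x∈p-y; x∈p⇒∣p-x∣<∣p∣; x∉p⇒x∈∁p; ∣∁p∣≡n∸∣p∣)
open import Data.Product using (_×_; _,_)
open import Data.Sum using (_⊎_; inj₁; inj₂)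
open import Data.List using (List; []; _∷_; length; filter)
open import Data.List.Properties using (filter-accept)
open import Data.List.Relation.Unary.All as All using (All; []; _∷_)
open import Data.List.Relation.Unary.All.Properties using (all-filter)
open import Data.List.Relation.Unary.Any as Any using (Any; here; there)
open import Data.List.Relation.Unary.AllPairs using (_∷_)
open import Data.List.Relation.Unary.Unique.Propositional using (Unique)
import Data.List.Relation.Unary.Unique.Propositional.Properties as Unique
open import Relation.Binary.PropositionalEquality using (_≡_; _≢_; refl; sym; trans; cong; subst)
open import Relation.Nullary using (¬?; yes; no)
open import Relation.Unary using (Pred; Decidable)

private
  variable
    ℓ : Level
    n : ℕ

-- m − (m − n) = min(m, n) ≤ n; used to read |V ∖ I| = n − (n − |M|) as ≤ |M|.
m∸[m∸n]≤n : ∀ m n → m ∸ (m ∸ n) ≤ n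
m∸[m∸n]≤n m n with ≤-total n m
... | inj₁ n≤m = ≤-reflexive (m∸[m∸n]≡n n≤m)
... | inj₂ m≤n = ≤-trans (m∸n≤m m (m ∸ n)) m≤n

-- A list of pairwise distinct elements of p has at most |p| entries:
-- removing the head from p lowers |p| and keeps the tail inside.
unique-length≤∣p∣ : (p : Subset n) (xs : List (Fin n)) →
                    Unique xs → All (_∈ p) xs → length xs ≤ ∣ p ∣
unique-length≤∣p∣ p [] _ _ = z≤n
unique-length≤∣p∣ p (x ∷ xs) (x∉xs ∷ uxs) (x∈p ∷ xs⊆p) =
  <-≤-trans (s≤s (unique-length≤∣p∣ (p - x) xs uxs (tail⊆p-x xs x∉xs xs⊆p)))
            (x∈p⇒∣p-x∣<∣p∣ x∈p)
  where
  tail⊆p-x : ∀ ys → All (x ≢_) ys → All (_∈ p) ys → All (_∈ p - x) ys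
  tail⊆p-x [] _ _ = []
  tail⊆p-x (y ∷ ys) (x≢y ∷ x≢ys) (y∈p ∷ ys⊆p) =
    x∈p∧x≢y⇒x∈p-y y∈p (x≢y ∘ sym) ∷ tail⊆p-x ys x≢ys ys⊆p

module EndpointCount {P : Pred (Fin n) ℓ} (P? : Decidable P) where

  count : List (Fin n) → ℕ
  count xs = length (filter P? xs)

  count-accept : ∀ {x} xs → P x → count (x ∷ xs) ≡ suc (count xs)
  count-accept xs px = cong length (filter-accept P? px)

  count-∷ : ∀ x xs → count xs ≤ count (x ∷ xs)
  count-∷ x xs with P? x
  ... | yes _ = n≤1+n (count xs)
  ... | no  _ = ≤-refl

  count-pair : ∀ {a b} xs → P a ⊎ P b → suc (count xs) ≤ count (a ∷ b ∷ xs)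
  count-pair {a} {b} xs (inj₁ pa) =
    subst (suc (count xs) ≤_) (sym (count-accept (b ∷ xs) pa)) (s≤s (count-∷ b xs))
  count-pair {a} {b} xs (inj₂ pb) =
    ≤-trans (≤-reflexive (sym (count-accept xs pb))) (count-∷ a (b ∷ xs))

  count-pair₂ : ∀ {a b} xs → P a → P b → suc (suc (count xs)) ≤ count (a ∷ b ∷ xs)
  count-pair₂ {a} {b} xs pa pb =
    ≤-reflexive (sym (trans (count-accept (b ∷ xs) pa) (cong suc (count-accept xs pb))))

  Touches : Fin n × Fin n → Set ℓ
  Touches (a , b) = P a ⊎ P b

  InsideBoth : Fin n × Fin n → Set ℓ
  InsideBoth (a , b) = P a × P b

  touches⇒length≤count : ∀ M → All Touches M → length M ≤ count (endpoints M)
  touches⇒length≤count [] [] = z≤n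
  touches⇒length≤count ((a , b) ∷ M) (t ∷ ts) =
    ≤-trans (s≤s (touches⇒length≤count M ts)) (count-pair (endpoints M) t)

  insideBoth⇒length<count : ∀ M → All Touches M → Any InsideBoth M →
                            suc (length M) ≤ count (endpoints M)
  insideBoth⇒length<count ((a , b) ∷ M) (_ ∷ ts) (here (pa , pb)) =
    ≤-trans (s≤s (s≤s (touches⇒length≤count M ts))) (count-pair₂ (endpoints M) pa pb)
  insideBoth⇒length<count ((a , b) ∷ M) (t ∷ ts) (there both) =
    ≤-trans (s≤s (insideBoth⇒length<count M ts both)) (count-pair (endpoints M) t)

module _ (G : SimpleGraph n) {I : Subset n} (ind : Independent G I) where

  edge-not-inside : ∀ {a b} → Edge G a b → a ∈ I → b ∈ I → ⊥
  edge-not-inside {a} {b} e a∈I b∈I with trans (sym e) (ind a b a∈I b∈I)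
  ... | ()

  edge-leaves : ∀ {a b} → Edge G a b → a ∉ I ⊎ b ∉ I
  edge-leaves {a} {b} e with a ∈? I
  ... | yes a∈I = inj₂ (edge-not-inside e a∈I)
  ... | no  a∉I = inj₁ a∉I

lemma2p4 : ∀ {n : ℕ} (G : SimpleGraph n) → Connected G →
           (M : List (Fin n × Fin n)) → IsMatching G M →
           (I : Subset n) → Independent G I → ∣ I ∣ ≡ n ∸ length M →
           ∀ (z x y : Fin n) → z ∈ I → Edge G y z → InMatching M x y → x ∈ I
lemma2p4 {n} G _ M (edges , distinct) I ind ∣I∣≡n∸∣M∣ z x y z∈I yz xy∈M with x ∈? I
... | yes x∈I = x∈I
... | no  x∉I = ⊥-elim (≤⇒≯ (m∸[m∸n]≤n n (length M)) |M|<n∸[n∸|M|])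
  where
  open EndpointCount (λ v → ¬? (v ∈? I))

  y∉I : y ∉ I
  y∉I y∈I = edge-not-inside G ind yz y∈I z∈I

  bothOutside : InMatching M x y → Any InsideBoth M
  bothOutside (inj₁ xy) = Any.map (λ { refl → x∉I , y∉I }) xy
  bothOutside (inj₂ yx) = Any.map (λ { refl → y∉I , x∉I }) yx

  outside≤∣∁I∣ : count (endpoints M) ≤ n ∸ ∣ I ∣
  outside≤∣∁I∣ = subst (count (endpoints M) ≤_) (∣∁p∣≡n∸∣p∣ I)
    (unique-length≤∣p∣ (∁ I) _ (Unique.filter⁺ _ distinct)
      (All.map x∉p⇒x∈∁p (all-filter _ (endpoints M))))

  |M|<n∸[n∸|M|] : length M < n ∸ (n ∸ length M)
  |M|<n∸[n∸|M|] = subst (length M <_) (cong (n ∸_) ∣I∣≡n∸∣M∣)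
    (≤-trans (insideBoth⇒length<count M (All.map (edge-leaves G ind) edges) (bothOutside xy∈M))
             outside≤∣∁I∣)
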